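{- Let $S=S(k_0,\dots,k_{m-1},k_m)\in\{L,R\}^*$. Then, if $S\neq\varepsilon$, $$P_C(S)=S(k_0,\dots,k_{m-1},k_m-1)\quad\text{and}\quad P_D(S)=S(k_0,\dots,k_{m-2},k_{m-1}-1);$$ moreover $$N(S)=2^{k_0+\cdots+k_m+1}+\sum_{i=1}^{m}(-1)^i\,2^{k_i+k_{i+1}+\cdots+k_m}+c_m,\qquad c_m=\begin{cases}-2&m\text{ even},\\-1&m\text{ odd},\end{cases}$$ and $$r(S)=2\Big(\sum_{i=0}^{m}(-1)^i2^{ -(k_0+\cdots+k_{i-1})}+(-1)^{m+1}2^{ -|S|-1}\Big)=2\sum_{i=0}^{m+1}(-1)^i2^{ -e_i}+(-1)^{m+2}2^{ -|S|},$$ where $e_i=\sum_{j=0}^{i-1}k_j$ (so $e_0=0$ and $e_{m+1}=|S|$).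
   Context: $\{L,R\}^*$ is the free monoid of finite strings in $L,R$ with empty string $\varepsilon$. For $k_0\in\mathbb{N}$ and integers $k_1,\dots,k_m\geq1$, $S(k_0,\dots,k_m)$ is the string $R^{k_0}L^{k_1}R^{k_2}\cdots$ with $m+1$ alternating blocks, the last block being $R^{k_m}$ if $m$ even and $L^{k_m}$ if $m$ odd; every string has a unique such form. Conventions for the parent formulas: a last exponent equal to $0$ means that block is empty; a first exponent $-1$ means the generalized string $R^{ -1}$; when $m=0$, $S(k_0,\dots,k_{m-2},k_{m-1}-1)$ means $L^{ -1}$. Right multiplication by $L^{ -1}$, $R^{ -1}$ is evaluated by the rules $LL^{ -1}=\varepsilon$, $RR^{ -1}=\varepsilon$, $LR^{ -1}=R^{ -1}$, $RL^{ -1}=L^{ -1}$; $P_L(S)=SR^{ -1}$, $P_R(S)=SL^{ -1}$. $|S|=k_0+\cdots+k_m$ is the length. The position function $N:\{L,R\}^*\to\mathbb{N}$ is defined by $N(\varepsilon)=0$, $N(SL)=2N(S)+1$, $N(SR)=2N(S)+2$. For $S\neq\varepsilon$, the close parent $P_C(S)$ is $P_L(S)$ if $N(S)$ is even and $P_R(S)$ if $N(S)$ is odd; the distant parent $P_D(S)$ is $P_L(S)$ if $N(S)$ is odd and $P_R(S)$ if $N(S)$ is even. The function $r$ is defined by $r(\varepsilon)=1$, $r(SL)=r(S)-2^{ -|SL|}$, $r(SR)=r(S)+2^{ -|SR|}$. -}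

module Defs where

open import Data.Nat as ℕ using (ℕ; zero; suc; _∸_)
open import Data.Bool using (Bool; true; false; if_then_else_)
open import Data.List using (List; []; _∷_; length; upTo; map; foldr; take; drop)
open import Data.Integer as ℤ using (ℤ; +_)
open import Data.Rational as ℚ using (ℚ; ½; 1ℚ; 0ℚ)

data Dir : Set where
  L R : Dir

infixl 5 _▸_
data Str : Set where
  ε   : Str
  _▸_ : Str → Dir → Str

len : Str → ℕ
len ε       = 0
len (s ▸ _) = suc (len s)

data GStr : Set where
  str  : Str → GStr
  Linv : GStr
  Rinv : GStr

_·R⁻¹ : Str → GStr
ε       ·R⁻¹ = Rinv
(s ▸ R) ·R⁻¹ = str s
(s ▸ L) ·R⁻¹ = s ·R⁻¹

_·L⁻¹ : Str → GStr
ε       ·L⁻¹ = Linv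
(s ▸ L) ·L⁻¹ = str s
(s ▸ R) ·L⁻¹ = s ·L⁻¹

P-L : Str → GStr
P-L s = s ·R⁻¹

P-R : Str → GStr
P-R s = s ·L⁻¹

N : Str → ℕ
N ε       = 0
N (s ▸ L) = suc (2 ℕ.* N s)
N (s ▸ R) = 2 ℕ.+ 2 ℕ.* N s

isEven : ℕ → Bool
isEven zero          = true
isEven (suc zero)    = false
isEven (suc (suc n)) = isEven n

P-C : Str → GStr
P-C s = if isEven (N s) then P-L s else P-R s

P-D : Str → GStr
P-D s = if isEven (N s) then P-R s else P-L s

inv2^ : ℕ → ℚ
inv2^ zero    = 1ℚ
inv2^ (suc n) = ½ ℚ.* inv2^ n

r : Str → ℚ
r ε       = 1ℚ
r (s ▸ L) = r s ℚ.- inv2^ (len (s ▸ L))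
r (s ▸ R) = r s ℚ.+ inv2^ (len (s ▸ R))

-- block notation S(k_0,…,k_m) = R^{k_0} L^{k_1} R^{k_2} …,
-- given by the list of exponents (k_0 ∷ k_1 ∷ … ∷ k_m ∷ []).
-- An exponent 0 contributes an empty block.
flip : Dir → Dir
flip L = R
flip R = L

rep : Str → Dir → ℕ → Str
rep s d zero    = s
rep s d (suc k) = rep s d k ▸ d

blocks : Str → Dir → List ℕ → Str
blocks s d []       = s
blocks s d (k ∷ ks) = blocks (rep s d k) (flip d) ks

Sb : List ℕ → Str
Sb ks = blocks ε R ks

decLast : List ℕ → List ℕ
decLast []           = []
decLast (x ∷ [])     = (x ∸ 1) ∷ []
decLast (x ∷ y ∷ t)  = x ∷ decLast (y ∷ t)

dropLast : List ℕ → List ℕ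
dropLast []          = []
dropLast (x ∷ [])    = []
dropLast (x ∷ y ∷ t) = x ∷ dropLast (y ∷ t)

-- S(k_0,…,k_{m-2},k_{m-1}-1) with the paper's conventions, given the list
-- (k_0,…,k_{m-1}) (i.e. dropLast of the full exponent list):
--   empty list (m = 0)                         : L^{-1}
--   single first exponent 0 (so 0 - 1 = -1)    : R^{-1}
--   otherwise                                  : the ordinary string
convS : List ℕ → GStr
convS []             = Linv
convS (zero ∷ [])    = Rinv
convS (suc k ∷ [])   = str (Sb (k ∷ []))
convS (x ∷ y ∷ t)    = str (Sb (decLast (x ∷ y ∷ t)))

sgnℤ : ℕ → ℤ
sgnℤ zero    = ℤ.+ 1
sgnℤ (suc i) = ℤ.- sgnℤ i

sgnℚ : ℕ → ℚ
sgnℚ zero    = 1ℚ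
sgnℚ (suc i) = ℚ.- sgnℚ i

sumℤ : List ℤ → ℤ
sumℤ = foldr ℤ._+_ (ℤ.+ 0)

sumℚ : List ℚ → ℚ
sumℚ = foldr ℚ._+_ 0ℚ

sumℕ : List ℕ → ℕ
sumℕ = foldr ℕ._+_ 0

module Submission where

-- The close parent of s ▸ d is s, because N (s ▸ d) is odd exactly when d = L; the distant
-- parent also deletes the rest of the final block, stopping after the last letter of the
-- other kind.  Along a block of d's both statistics are affine: N + o_d doubles with every
-- letter (o_L = 1, o_R = 2), and r moves by ±2^(-|s|)(1 - 2^(-k)) with the sign of d.
-- Passing to the next block flips d, which flips that sign and changes o_d by exactly it,
-- so an induction over the blocks produces the alternating sums.

open import Defs
open import Data.Nat using (ℕ; zero; suc; _≤_; _^_; s≤s; z≤n)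
open import Data.Nat as ℕ using ()
import Data.Nat.Properties as ℕ
open import Data.Bool using (true; false; not; if_then_else_)
open import Data.List using (List; []; _∷_; length; upTo; map; take; drop; foldr; applyUpTo)
open import Data.List.Properties using (map-upTo)
open import Data.List.Relation.Unary.All using (All; []; _∷_)
open import Data.Integer as ℤ using (ℤ; +_; -[1+_])
import Data.Integer.Properties as ℤ
open import Data.Integer.Solver using (module +-*-Solver)
open import Data.Rational.Solver renaming (module +-*-Solver to QSolver)
open import Data.Nat.Tactic.RingSolver using (solve-∀)
open import Data.Rational as ℚ using (ℚ; ½; 1ℚ; 0ℚ)
import Data.Rational.Properties as ℚ
open import Data.Product using (_×_; _,_; proj₁; proj₂)
open import Data.Empty using (⊥-elim)
open import Algebra.Bundles using (Semiring; CommutativeRing)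
open import Function using (_∘_)
open import Relation.Binary.PropositionalEquality
  using (_≡_; _≢_; refl; sym; trans; cong; cong₂; module ≡-Reasoning)

module _ {c ℓ} (R : Semiring c ℓ) where
  open Semiring R using (Carrier; _≈_; _+_; _*_; 0#; setoid; +-cong; zeroʳ; distribˡ)
  open import Relation.Binary.Reasoning.Setoid setoid

  sum-applyUpTo-scale : ∀ a (f g : ℕ → Carrier) n → (∀ i → g i ≈ a * f i) →
    foldr _+_ 0# (applyUpTo g n) ≈ a * foldr _+_ 0# (applyUpTo f n)
  sum-applyUpTo-scale a f g zero g≈af = begin 0# ≈⟨ zeroʳ a ⟨ a * 0# ∎
  sum-applyUpTo-scale a f g (suc n) g≈af = begin
      g 0 + foldr _+_ 0# (applyUpTo (g ∘ suc) n)
    ≈⟨ +-cong (g≈af 0) (sum-applyUpTo-scale a (f ∘ suc) (g ∘ suc) n (g≈af ∘ suc)) ⟩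
      a * f 0 + a * foldr _+_ 0# (applyUpTo (f ∘ suc) n)
    ≈⟨ distribˡ a (f 0) _ ⟨
      a * foldr _+_ 0# (applyUpTo f (suc n))
    ∎

isEven-suc : ∀ n → isEven (suc n) ≡ not (isEven n)
isEven-suc zero          = refl
isEven-suc (suc zero)    = refl
isEven-suc (suc (suc n)) = isEven-suc n

isEven-double : ∀ n → isEven (2 ℕ.* n) ≡ true
isEven-double zero = refl
isEven-double (suc n) rewrite ℕ.+-suc n (n ℕ.+ 0) = isEven-double n

_·_⁻¹ : Str → Dir → GStr
s · L ⁻¹ = s ·L⁻¹
s · R ⁻¹ = s ·R⁻¹

P-C-▸ : ∀ s d → P-C (s ▸ d) ≡ str s
P-C-▸ s L rewrite isEven-suc (2 ℕ.* N s) | isEven-double (N s) = refl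
P-C-▸ s R rewrite isEven-double (N s) = refl

P-D-▸ : ∀ s d → P-D (s ▸ d) ≡ s · flip d ⁻¹
P-D-▸ s L rewrite isEven-suc (2 ℕ.* N s) | isEven-double (N s) = refl
P-D-▸ s R rewrite isEven-double (N s) = refl

rep-·⁻¹ : ∀ s d n → rep s d n · flip d ⁻¹ ≡ s · flip d ⁻¹
rep-·⁻¹ s d zero    = refl
rep-·⁻¹ s L (suc n) = rep-·⁻¹ s L n
rep-·⁻¹ s R (suc n) = rep-·⁻¹ s R n

lastDir : Dir → List ℕ → Dir
lastDir d []           = d
lastDir d (_ ∷ [])     = d
lastDir d (_ ∷ k ∷ ks) = lastDir (flip d) (k ∷ ks)

blocks-decLast : ∀ s d k ks → All (λ k → 1 ≤ k) (k ∷ ks) →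
  blocks s d (k ∷ ks) ≡ blocks s d (decLast (k ∷ ks)) ▸ lastDir d (k ∷ ks)
blocks-decLast s d (suc k) []        _         = refl
blocks-decLast s d k       (k′ ∷ ks) (_ ∷ 1≤ks) = blocks-decLast (rep s d k) (flip d) k′ ks 1≤ks

blocks-dropLast : ∀ s d k k′ ks → All (λ k → 1 ≤ k) (k ∷ k′ ∷ ks) →
  blocks s d (decLast (k ∷ k′ ∷ ks)) · flip (lastDir d (k ∷ k′ ∷ ks)) ⁻¹
    ≡ str (blocks s d (decLast (dropLast (k ∷ k′ ∷ ks))))
blocks-dropLast s L (suc k) k′ []         _          = rep-·⁻¹ (rep s L (suc k)) R (k′ ℕ.∸ 1)
blocks-dropLast s R (suc k) k′ []         _          = rep-·⁻¹ (rep s R (suc k)) L (k′ ℕ.∸ 1)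
blocks-dropLast s d k       k′ (k″ ∷ ks) (_ ∷ 1≤ks) = blocks-dropLast (rep s d k) (flip d) k′ k″ ks 1≤ks

parents-▸ : ∀ {S} s d → S ≡ s ▸ d → (P-C S ≡ str s) × (P-D S ≡ s · flip d ⁻¹)
parents-▸ s d refl = P-C-▸ s d , P-D-▸ s d

parents-one-block : ∀ s d k → 1 ≤ k →
  (P-C (blocks s d (k ∷ [])) ≡ str (blocks s d (decLast (k ∷ [])))) × (P-D (blocks s d (k ∷ [])) ≡ s · flip d ⁻¹)
parents-one-block s d (suc k) _ with parents-▸ (rep s d k) d refl
... | close , distant = close , trans distant (rep-·⁻¹ s d k)

parents-blocks : ∀ s d k k′ ks → All (λ k → 1 ≤ k) (k ∷ k′ ∷ ks) →
  let K = k ∷ k′ ∷ ks in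
  (P-C (blocks s d K) ≡ str (blocks s d (decLast K))) × (P-D (blocks s d K) ≡ str (blocks s d (decLast (dropLast K))))
parents-blocks s d k k′ ks 1≤K with parents-▸ _ _ (blocks-decLast s d k (k′ ∷ ks) 1≤K)
... | close , distant = close , trans distant (blocks-dropLast s d k k′ ks 1≤K)

parents-Sb : ∀ k₀ ks → All (λ k → 1 ≤ k) ks → Sb (k₀ ∷ ks) ≢ ε →
  (P-C (Sb (k₀ ∷ ks)) ≡ str (Sb (decLast (k₀ ∷ ks)))) × (P-D (Sb (k₀ ∷ ks)) ≡ convS (dropLast (k₀ ∷ ks)))
parents-Sb zero    []              _           S≢ε = ⊥-elim (S≢ε refl)
parents-Sb (suc k) []              _           _   = parents-one-block ε R (suc k) (s≤s z≤n)
parents-Sb k₀      (k₁ ∷ [])       (1≤k₁ ∷ []) _   with parents-one-block (rep ε R k₀) L k₁ 1≤k₁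
... | close , distant = close , trans distant (rep-·R⁻¹ k₀)
  where
  rep-·R⁻¹ : ∀ k → rep ε R k · R ⁻¹ ≡ convS (k ∷ [])
  rep-·R⁻¹ zero    = refl
  rep-·R⁻¹ (suc k) = refl
parents-Sb k₀      (k₁ ∷ k₂ ∷ ks) 1≤ks        _   with parents-blocks (rep ε R k₀) L k₁ k₂ ks 1≤ks
... | close , distant = close , trans distant (sym (convS-∷-∷ k₀ k₁ (dropLast (k₂ ∷ ks))))
  where
  -- convS inspects the first exponent before the length of the list, so it is stuck here.
  convS-∷-∷ : ∀ k k′ ks → convS (k ∷ k′ ∷ ks) ≡ str (Sb (decLast (k ∷ k′ ∷ ks)))
  convS-∷-∷ zero    _ _ = refl
  convS-∷-∷ (suc k) _ _ = refl

offset : Dir → ℕ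
offset L = 1
offset R = 2

signℤ : Dir → ℤ
signℤ L = -[1+ 0 ]
signℤ R = + 1

offset-flip : ∀ d → + offset (flip d) ≡ + offset d ℤ.- signℤ d
offset-flip L = refl
offset-flip R = refl

signℤ-flip : ∀ d → signℤ (flip d) ≡ ℤ.- signℤ d
signℤ-flip L = refl
signℤ-flip R = refl

N-▸ : ∀ s d → N (s ▸ d) ≡ offset d ℕ.+ 2 ℕ.* N s
N-▸ s L = refl
N-▸ s R = refl

N-rep : ∀ s d k → N (rep s d k) ℕ.+ offset d ≡ 2 ^ k ℕ.* (N s ℕ.+ offset d)
N-rep s d zero    = sym (ℕ.*-identityˡ _)
N-rep s d (suc k) = begin
    N (rep s d k ▸ d) ℕ.+ offset d
  ≡⟨ cong (ℕ._+ offset d) (N-▸ (rep s d k) d) ⟩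
    offset d ℕ.+ 2 ℕ.* N (rep s d k) ℕ.+ offset d
  ≡⟨ double (offset d) (N (rep s d k)) ⟩
    2 ℕ.* (N (rep s d k) ℕ.+ offset d)
  ≡⟨ cong (2 ℕ.*_) (N-rep s d k) ⟩
    2 ℕ.* (2 ^ k ℕ.* (N s ℕ.+ offset d))
  ≡⟨ ℕ.*-assoc 2 (2 ^ k) _ ⟨
    2 ^ suc k ℕ.* (N s ℕ.+ offset d)
  ∎
  where
  open ≡-Reasoning
  double : ∀ o n → o ℕ.+ 2 ℕ.* n ℕ.+ o ≡ 2 ℕ.* (n ℕ.+ o)
  double = solve-∀

N-rep-ℤ : ∀ s d k → + N (rep s d k) ℤ.+ + offset d ≡ + (2 ^ k) ℤ.* (+ N s ℤ.+ + offset d)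
N-rep-ℤ s d k = trans (cong +_ (N-rep s d k)) (ℤ.pos-* (2 ^ k) (N s ℕ.+ offset d))

tailSum : List ℕ → ℤ
tailSum ks = sumℤ (applyUpTo (λ j → sgnℤ (suc j) ℤ.* + (2 ^ sumℕ (drop j ks))) (length ks))

pos-2^-+ : ∀ m n → + (2 ^ (m ℕ.+ n)) ≡ + (2 ^ m) ℤ.* + (2 ^ n)
pos-2^-+ m n = trans (cong +_ (ℕ.^-distribˡ-+-* 2 m n)) (ℤ.pos-* (2 ^ m) (2 ^ n))

tailSum-∷ : ∀ k ks → tailSum (k ∷ ks) ≡ ℤ.- + (2 ^ (k ℕ.+ sumℕ ks)) ℤ.- tailSum ks
tailSum-∷ k ks = cong₂ ℤ._+_ (ℤ.-1*i≡-i (+ (2 ^ (k ℕ.+ sumℕ ks))))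
  (trans (sum-applyUpTo-scale ℤ.+-*-semiring (-[1+ 0 ]) term shifted (length ks) negate) (ℤ.-1*i≡-i (tailSum ks)))
  where
  term : ℕ → ℤ
  term j = sgnℤ (suc j) ℤ.* + (2 ^ sumℕ (drop j ks))
  shifted : ℕ → ℤ
  shifted j = sgnℤ (suc (suc j)) ℤ.* + (2 ^ sumℕ (drop j ks))
  negate : ∀ j → shifted j ≡ -[1+ 0 ] ℤ.* term j
  negate j = trans (sym (ℤ.neg-distribˡ-* (sgnℤ (suc j)) (+ (2 ^ sumℕ (drop j ks))))) (sym (ℤ.-1*i≡-i (term j)))

parityℤ : ℕ → ℤ
parityℤ m = if isEven m then + 0 else + 1

parityℤ-suc : ∀ m → parityℤ (suc m) ≡ + 1 ℤ.- parityℤ m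
parityℤ-suc m rewrite isEven-suc m with isEven m
... | true  = refl
... | false = refl

N-blocks-step : ∀ {X x n o o′ σ σ′ P Q t p} → o′ ≡ o ℤ.- σ → σ′ ≡ ℤ.- σ →
  X ℤ.+ o′ ≡ Q ℤ.* (n ℤ.+ o′) ℤ.+ σ′ ℤ.* (t ℤ.+ p) → n ℤ.+ o ≡ P ℤ.* (x ℤ.+ o) →
  X ℤ.+ o ≡ P ℤ.* Q ℤ.* (x ℤ.+ o) ℤ.+ σ ℤ.* ((ℤ.- Q ℤ.- t) ℤ.+ (+ 1 ℤ.- p))
N-blocks-step {X} {x} {n} {o} {_} {σ} {_} {P} {Q} {t} {p} refl refl IH n+o = begin
    X ℤ.+ o
  ≡⟨ solve 3 (λ X o σ → X :+ o := X :+ (o :- σ) :+ σ) refl X o σ ⟩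
    X ℤ.+ (o ℤ.- σ) ℤ.+ σ
  ≡⟨ cong (ℤ._+ σ) IH ⟩
    Q ℤ.* (n ℤ.+ (o ℤ.- σ)) ℤ.+ (ℤ.- σ) ℤ.* (t ℤ.+ p) ℤ.+ σ
  ≡⟨ cong (λ y → Q ℤ.* y ℤ.+ (ℤ.- σ) ℤ.* (t ℤ.+ p) ℤ.+ σ) (ℤ.+-assoc n o (ℤ.- σ)) ⟨
    Q ℤ.* ((n ℤ.+ o) ℤ.- σ) ℤ.+ (ℤ.- σ) ℤ.* (t ℤ.+ p) ℤ.+ σ
  ≡⟨ cong (λ y → Q ℤ.* (y ℤ.- σ) ℤ.+ (ℤ.- σ) ℤ.* (t ℤ.+ p) ℤ.+ σ) n+o ⟩
    Q ℤ.* (P ℤ.* (x ℤ.+ o) ℤ.- σ) ℤ.+ (ℤ.- σ) ℤ.* (t ℤ.+ p) ℤ.+ σ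
  ≡⟨ solve 6 (λ y σ P Q t p → Q :* (P :* y :- σ) :+ (:- σ) :* (t :+ p) :+ σ
                               := P :* Q :* y :+ σ :* ((:- Q :- t) :+ (con (+ 1) :- p)))
             refl (x ℤ.+ o) σ P Q t p ⟩
    P ℤ.* Q ℤ.* (x ℤ.+ o) ℤ.+ σ ℤ.* ((ℤ.- Q ℤ.- t) ℤ.+ (+ 1 ℤ.- p))
  ∎
  where
  open ≡-Reasoning
  open +-*-Solver

N-blocks : ∀ s d k ks → + N (blocks s d (k ∷ ks)) ℤ.+ + offset d
  ≡ + (2 ^ sumℕ (k ∷ ks)) ℤ.* (+ N s ℤ.+ + offset d) ℤ.+ signℤ d ℤ.* (tailSum ks ℤ.+ parityℤ (length ks))
N-blocks s d k [] rewrite ℕ.+-identityʳ k =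
  trans (N-rep-ℤ s d k)
        (solve 4 (λ P x o σ → P :* (x :+ o) := P :* (x :+ o) :+ σ :* con (+ 0)) refl (+ (2 ^ k)) (+ N s) (+ offset d) (signℤ d))
  where open +-*-Solver
N-blocks s d k (k′ ∷ ks) = begin
    + N (blocks (rep s d k) (flip d) (k′ ∷ ks)) ℤ.+ + offset d
  ≡⟨ N-blocks-step {X = + N (blocks (rep s d k) (flip d) (k′ ∷ ks))} {x = + N s} {n = + N (rep s d k)}
                 {o = + offset d} {P = + (2 ^ k)} {Q = + (2 ^ Σ′)}
       (offset-flip d) (signℤ-flip d) (N-blocks (rep s d k) (flip d) k′ ks) (N-rep-ℤ s d k) ⟩
    + (2 ^ k) ℤ.* + (2 ^ Σ′) ℤ.* (+ N s ℤ.+ + offset d)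
      ℤ.+ signℤ d ℤ.* ((ℤ.- + (2 ^ Σ′) ℤ.- tailSum ks) ℤ.+ (+ 1 ℤ.- parityℤ (length ks)))
  ≡⟨ cong₂ (λ a b → a ℤ.* (+ N s ℤ.+ + offset d) ℤ.+ signℤ d ℤ.* b)
       (sym (pos-2^-+ k Σ′)) (sym (cong₂ ℤ._+_ (tailSum-∷ k′ ks) (parityℤ-suc (length ks)))) ⟩
    + (2 ^ (k ℕ.+ Σ′)) ℤ.* (+ N s ℤ.+ + offset d) ℤ.+ signℤ d ℤ.* (tailSum (k′ ∷ ks) ℤ.+ parityℤ (suc (length ks)))
  ∎
  where
  open ≡-Reasoning
  Σ′ = sumℕ (k′ ∷ ks)

signℚ : Dir → ℚ
signℚ L = ℚ.- 1ℚ
signℚ R = 1ℚ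

signℚ-flip : ∀ d → signℚ (flip d) ≡ ℚ.- signℚ d
signℚ-flip L = refl
signℚ-flip R = refl

len-rep : ∀ s d k → len (rep s d k) ≡ k ℕ.+ len s
len-rep s d zero    = refl
len-rep s d (suc k) = cong suc (len-rep s d k)

inv2^-+ : ∀ m n → inv2^ (m ℕ.+ n) ≡ inv2^ m ℚ.* inv2^ n
inv2^-+ zero    n = sym (ℚ.*-identityˡ (inv2^ n))
inv2^-+ (suc m) n = trans (cong (½ ℚ.*_) (inv2^-+ m n)) (sym (ℚ.*-assoc ½ (inv2^ m) (inv2^ n)))

r-▸ : ∀ s d → r (s ▸ d) ≡ r s ℚ.+ signℚ d ℚ.* inv2^ (suc (len s))
r-▸ s L = cong (r s ℚ.+_) (trans (cong ℚ.-_ (sym (ℚ.*-identityˡ _))) (ℚ.neg-distribˡ-* 1ℚ (inv2^ (suc (len s)))))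
r-▸ s R = cong (r s ℚ.+_) (sym (ℚ.*-identityˡ _))

r-rep : ∀ s d k → r (rep s d k) ≡ r s ℚ.+ signℚ d ℚ.* inv2^ (len s) ℚ.* (1ℚ ℚ.- inv2^ k)
r-rep s d zero    = solve 3 (λ x σ a → x := x :+ σ :* a :* (con 1ℚ :- con 1ℚ)) refl (r s) (signℚ d) (inv2^ (len s))
  where open QSolver
r-rep s d (suc k) = begin
    r (rep s d k ▸ d)
  ≡⟨ r-▸ (rep s d k) d ⟩
    r (rep s d k) ℚ.+ signℚ d ℚ.* inv2^ (suc (len (rep s d k)))
  ≡⟨ cong₂ (λ x e → x ℚ.+ signℚ d ℚ.* (½ ℚ.* e)) (r-rep s d k) (trans (cong inv2^ (len-rep s d k)) (inv2^-+ k (len s))) ⟩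
    r s ℚ.+ signℚ d ℚ.* inv2^ (len s) ℚ.* (1ℚ ℚ.- inv2^ k) ℚ.+ signℚ d ℚ.* (½ ℚ.* (inv2^ k ℚ.* inv2^ (len s)))
  ≡⟨ solve 4 (λ x σ a b → x :+ σ :* a :* (con 1ℚ :- b) :+ σ :* (con ½ :* (b :* a))
                       := x :+ σ :* a :* (con 1ℚ :- con ½ :* b))
       refl (r s) (signℚ d) (inv2^ (len s)) (inv2^ k) ⟩
    r s ℚ.+ signℚ d ℚ.* inv2^ (len s) ℚ.* (1ℚ ℚ.- inv2^ (suc k))
  ∎
  where
  open ≡-Reasoning
  open QSolver

alternatingSum : List ℕ → ℕ → ℚ
alternatingSum K n = sumℚ (applyUpTo (λ i → sgnℚ i ℚ.* inv2^ (sumℕ (take i K))) n)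

alternatingSum-∷ : ∀ k ks n → alternatingSum (k ∷ ks) (suc n) ≡ 1ℚ ℚ.- inv2^ k ℚ.* alternatingSum ks n
alternatingSum-∷ k ks n = cong (1ℚ ℚ.+_)
  (trans (sum-applyUpTo-scale (CommutativeRing.semiring ℚ.+-*-commutativeRing) (ℚ.- inv2^ k) term shifted n scale)
         (sym (ℚ.neg-distribˡ-* (inv2^ k) (alternatingSum ks n))))
  where
  term shifted : ℕ → ℚ
  term i = sgnℚ i ℚ.* inv2^ (sumℕ (take i ks))
  shifted i = sgnℚ (suc i) ℚ.* inv2^ (k ℕ.+ sumℕ (take i ks))
  scale : ∀ i → shifted i ≡ ℚ.- inv2^ k ℚ.* term i
  scale i rewrite inv2^-+ k (sumℕ (take i ks)) =
    solve 3 (λ σ b e → (:- σ) :* (b :* e) := (:- b) :* (σ :* e)) refl (sgnℚ i) (inv2^ k) (inv2^ (sumℕ (take i ks)))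
    where open QSolver

alternatingSum-last : ∀ K → alternatingSum K (suc (length K))
  ≡ alternatingSum K (length K) ℚ.+ sgnℚ (length K) ℚ.* inv2^ (sumℕ K)
alternatingSum-last []       = refl
alternatingSum-last (k ∷ ks) = begin
    alternatingSum (k ∷ ks) (suc (suc m))
  ≡⟨ alternatingSum-∷ k ks (suc m) ⟩
    1ℚ ℚ.- b ℚ.* alternatingSum ks (suc m)
  ≡⟨ cong (λ g → 1ℚ ℚ.- b ℚ.* g) (alternatingSum-last ks) ⟩
    1ℚ ℚ.- b ℚ.* (alternatingSum ks m ℚ.+ sgnℚ m ℚ.* p)
  ≡⟨ solve 4 (λ b g c p → con 1ℚ :- b :* (g :+ c :* p) := (con 1ℚ :- b :* g) :+ (:- c) :* (b :* p))
       refl b (alternatingSum ks m) (sgnℚ m) p ⟩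
    (1ℚ ℚ.- b ℚ.* alternatingSum ks m) ℚ.+ ℚ.- sgnℚ m ℚ.* (b ℚ.* p)
  ≡⟨ cong₂ (λ g e → g ℚ.+ ℚ.- sgnℚ m ℚ.* e) (alternatingSum-∷ k ks m) (inv2^-+ k (sumℕ ks)) ⟨
    alternatingSum (k ∷ ks) (suc m) ℚ.+ sgnℚ (suc m) ℚ.* inv2^ (k ℕ.+ sumℕ ks)
  ∎
  where
  open ≡-Reasoning
  open QSolver
  m = length ks
  b = inv2^ k
  p = inv2^ (sumℕ ks)

r-blocks : ∀ s d K → r (blocks s d K) ≡ r s ℚ.+ signℚ d ℚ.* inv2^ (len s)
  ℚ.* ((+ 2 ℚ./ 1) ℚ.* alternatingSum K (length K) ℚ.- 1ℚ ℚ.+ sgnℚ (length K) ℚ.* inv2^ (sumℕ K))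
r-blocks s d [] = solve 3 (λ x σ a → x := x :+ σ :* a :* (con (+ 2 ℚ./ 1) :* con 0ℚ :- con 1ℚ :+ con 1ℚ :* con 1ℚ))
  refl (r s) (signℚ d) (inv2^ (len s))
  where open QSolver
r-blocks s d (k ∷ ks) = begin
    r (blocks (rep s d k) (flip d) ks)
  ≡⟨ r-blocks (rep s d k) (flip d) ks ⟩
    r (rep s d k) ℚ.+ signℚ (flip d) ℚ.* inv2^ (len (rep s d k)) ℚ.* E
  ≡⟨ cong₂ (λ x e → x ℚ.+ signℚ (flip d) ℚ.* e ℚ.* E) (r-rep s d k)
       (trans (cong inv2^ (len-rep s d k)) (inv2^-+ k (len s))) ⟩
    r s ℚ.+ σ ℚ.* a ℚ.* (1ℚ ℚ.- b) ℚ.+ signℚ (flip d) ℚ.* (b ℚ.* a) ℚ.* E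
  ≡⟨ cong (λ σ′ → r s ℚ.+ σ ℚ.* a ℚ.* (1ℚ ℚ.- b) ℚ.+ σ′ ℚ.* (b ℚ.* a) ℚ.* E) (signℚ-flip d) ⟩
    r s ℚ.+ σ ℚ.* a ℚ.* (1ℚ ℚ.- b) ℚ.+ ℚ.- σ ℚ.* (b ℚ.* a) ℚ.* E
  ≡⟨ solve 7 (λ x σ a b g c p →
         x :+ σ :* a :* (con 1ℚ :- b) :+ (:- σ) :* (b :* a) :* (con (+ 2 ℚ./ 1) :* g :- con 1ℚ :+ c :* p)
      := x :+ σ :* a :* (con (+ 2 ℚ./ 1) :* (con 1ℚ :- b :* g) :- con 1ℚ :+ (:- c) :* (b :* p)))
       refl (r s) σ a b g (sgnℚ m) p ⟩
    r s ℚ.+ σ ℚ.* a ℚ.* ((+ 2 ℚ./ 1) ℚ.* (1ℚ ℚ.- b ℚ.* g) ℚ.- 1ℚ ℚ.+ ℚ.- sgnℚ m ℚ.* (b ℚ.* p))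
  ≡⟨ cong₂ (λ g′ e → r s ℚ.+ σ ℚ.* a ℚ.* ((+ 2 ℚ./ 1) ℚ.* g′ ℚ.- 1ℚ ℚ.+ ℚ.- sgnℚ m ℚ.* e))
       (alternatingSum-∷ k ks m) (inv2^-+ k (sumℕ ks)) ⟨
    r s ℚ.+ σ ℚ.* a ℚ.* ((+ 2 ℚ./ 1) ℚ.* alternatingSum (k ∷ ks) (suc m) ℚ.- 1ℚ ℚ.+ sgnℚ (suc m) ℚ.* inv2^ (k ℕ.+ sumℕ ks))
  ∎
  where
  open ≡-Reasoning
  open QSolver
  m = length ks
  σ = signℚ d
  a = inv2^ (len s)
  b = inv2^ k
  g = alternatingSum ks m
  p = inv2^ (sumℕ ks)
  E = (+ 2 ℚ./ 1) ℚ.* g ℚ.- 1ℚ ℚ.+ sgnℚ m ℚ.* p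

N-Sb : ∀ k₀ ks → let m = length ks in
  + N (Sb (k₀ ∷ ks)) ≡ (+ (2 ^ suc (sumℕ (k₀ ∷ ks)))
                        ℤ.+ sumℤ (map (λ j → sgnℤ (suc j) ℤ.* + (2 ^ sumℕ (drop j ks))) (upTo m)))
                       ℤ.+ (if isEven m then -[1+ 1 ] else -[1+ 0 ])
N-Sb k₀ ks = begin
    + N S
  ≡⟨ solve 1 (λ n → n := n :+ con (+ 2) :- con (+ 2)) refl (+ N S) ⟩
    + N S ℤ.+ + 2 ℤ.- + 2
  ≡⟨ cong (ℤ._- + 2) (N-blocks ε R k₀ ks) ⟩
    Q ℤ.* + 2 ℤ.+ + 1 ℤ.* (tailSum ks ℤ.+ parityℤ m) ℤ.- + 2
  ≡⟨ solve 3 (λ Q t p → Q :* con (+ 2) :+ con (+ 1) :* (t :+ p) :- con (+ 2) := (con (+ 2) :* Q :+ t) :+ (p :- con (+ 2)))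
       refl Q (tailSum ks) (parityℤ m) ⟩
    (+ 2 ℤ.* Q ℤ.+ tailSum ks) ℤ.+ (parityℤ m ℤ.- + 2)
  ≡⟨ cong₂ ℤ._+_ (cong₂ ℤ._+_ (sym (ℤ.pos-* 2 (2 ^ sumℕ (k₀ ∷ ks)))) (sym (cong sumℤ (map-upTo _ m))))
                 (sym (parity-offset m)) ⟩
    _
  ∎
  where
  open ≡-Reasoning
  open +-*-Solver
  S = Sb (k₀ ∷ ks)
  m = length ks
  Q = + (2 ^ sumℕ (k₀ ∷ ks))
  parity-offset : ∀ m → (if isEven m then -[1+ 1 ] else -[1+ 0 ]) ≡ parityℤ m ℤ.- + 2
  parity-offset m with isEven m
  ... | true  = refl
  ... | false = refl

r-Sb : ∀ K → let n = length K ; c = sgnℚ n ; p = inv2^ (sumℕ K) in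
  r (Sb K) ≡ (+ 2 ℚ./ 1) ℚ.* (alternatingSum K n ℚ.+ c ℚ.* (½ ℚ.* p))
  × r (Sb K) ≡ (+ 2 ℚ./ 1) ℚ.* alternatingSum K (suc n) ℚ.+ sgnℚ (suc n) ℚ.* p
r-Sb K = trans (r-blocks ε R K)
           (solve 3 (λ g c p → con 1ℚ :+ con 1ℚ :* con 1ℚ :* (con (+ 2 ℚ./ 1) :* g :- con 1ℚ :+ c :* p)
                               := con (+ 2 ℚ./ 1) :* (g :+ c :* (con ½ :* p))) refl g c p)
       , trans (r-blocks ε R K)
           (trans (solve 3 (λ g c p → con 1ℚ :+ con 1ℚ :* con 1ℚ :* (con (+ 2 ℚ./ 1) :* g :- con 1ℚ :+ c :* p)
                                      := con (+ 2 ℚ./ 1) :* (g :+ c :* p) :+ (:- c) :* p) refl g c p)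
                  (cong (λ h → (+ 2 ℚ./ 1) ℚ.* h ℚ.+ ℚ.- c ℚ.* p) (sym (alternatingSum-last K))))
  where
  open QSolver
  g = alternatingSum K (length K)
  c = sgnℚ (length K)
  p = inv2^ (sumℕ K)

theorem2p2 : (k₀ : ℕ) (ks : List ℕ) → All (λ k → 1 ≤ k) ks →
  let K = k₀ ∷ ks
      m = length ks
      S = Sb K
  in (S ≢ ε → (P-C S ≡ str (Sb (decLast K))) × (P-D S ≡ convS (dropLast K)))
     × (+ N S ≡ (+ (2 ^ suc (sumℕ K))
                 ℤ.+ sumℤ (map (λ j → sgnℤ (suc j) ℤ.* + (2 ^ sumℕ (drop j ks))) (upTo m)))
                 ℤ.+ (if isEven m then -[1+ 1 ] else -[1+ 0 ]))
     × (r S ≡ (+ 2 ℚ./ 1) ℚ.* (sumℚ (map (λ i → sgnℚ i ℚ.* inv2^ (sumℕ (take i K))) (upTo (suc m)))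
                                ℚ.+ sgnℚ (suc m) ℚ.* inv2^ (suc (sumℕ K))))
     × (r S ≡ (+ 2 ℚ./ 1) ℚ.* sumℚ (map (λ i → sgnℚ i ℚ.* inv2^ (sumℕ (take i K))) (upTo (suc (suc m))))
              ℚ.+ sgnℚ (suc (suc m)) ℚ.* inv2^ (sumℕ K))
theorem2p2 k₀ ks 1≤ks =
  parents-Sb k₀ ks 1≤ks ,
  N-Sb k₀ ks ,
  trans (proj₁ (r-Sb K)) (cong (λ h → (+ 2 ℚ./ 1) ℚ.* (h ℚ.+ sgnℚ (suc m) ℚ.* inv2^ (suc (sumℕ K))))
                               (sym (alternatingSum-upTo (suc m)))) ,
  trans (proj₂ (r-Sb K)) (cong (λ h → (+ 2 ℚ./ 1) ℚ.* h ℚ.+ sgnℚ (suc (suc m)) ℚ.* inv2^ (sumℕ K))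
                               (sym (alternatingSum-upTo (suc (suc m)))))
  where
  K = k₀ ∷ ks
  m = length ks
  alternatingSum-upTo : ∀ n → sumℚ (map (λ i → sgnℚ i ℚ.* inv2^ (sumℕ (take i K))) (upTo n)) ≡ alternatingSum K n
  alternatingSum-upTo n = cong sumℚ (map-upTo _ n)
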